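{- Let $n,d\in\mathbb{N}$, $\mathbf{x}=(x_1,\dots,x_n)\in\mathbb{Z}^n$, and let $\alpha,q$ be integers with $\alpha>d$ and $q>d\sum_{i=1}^n|x_i|$. Let $\mathcal{L}_{\alpha,q}\subseteq\mathbb{Z}^{n+1}$ be the lattice generated by the rows of \[ \mathbf{B}_{\alpha,q}= \begin{pmatrix} \alpha q & 0 & \cdots & 0\\ \alpha x_1 & 1 & & \\ \vdots & & \ddots & \\ \alpha x_n & & & 1 \end{pmatrix}\in\mathbb{Z}^{(n+1)\times(n+1)}. \] Then \[ \mathcal{L}_{\alpha,q}\cap d\,\mathbf{B}_\infty^{n+1}=\Bigl\{(0,c_1,\dots,c_n)\in\mathbb{Z}^{n+1}\ \Bigm|\ \sum_{i=1}^nc_ix_i=0,\ |c_i|\le d\ \text{for all } i\Bigr\}. \]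
   Context: $\mathbf{B}_\infty^{m}=\{\mathbf{y}\in\mathbb{R}^m:\|\mathbf{y}\|_\infty\le 1\}$ is the unit $\ell_\infty$ ball; the first row of $\mathbf{B}_{\alpha,q}$ is $(\alpha q,0,\dots,0)$ and row $i+1$ is $\alpha x_i$ in the first coordinate, $1$ in coordinate $i+1$, and $0$ elsewhere. -}

module Defs where

open import Data.Nat using (ℕ; suc)
open import Data.Integer using (ℤ; +_; _+_; _*_; ∣_∣; _≤_)
open import Data.Fin using (Fin; zero; suc)
import Data.Fin
import Relation.Nullary
open import Data.Product using (Σ; _×_)
open import Relation.Binary.PropositionalEquality using (_≡_)

sumFin : (n : ℕ) → (Fin n → ℤ) → ℤ
sumFin ℕ.zero f = + 0
sumFin (suc n) f = f zero + sumFin n (λ i → f (suc i))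

-- The basis matrix B_{α,q}: row index, column index; index 0 is the first row/column.
Bmat : (n : ℕ) → (x : Fin n → ℤ) → (α q : ℤ) → Fin (suc n) → Fin (suc n) → ℤ
Bmat n x α q zero    zero    = α * q
Bmat n x α q zero    (suc j) = + 0
Bmat n x α q (suc i) zero    = α * x i
Bmat n x α q (suc i) (suc j) with i Data.Fin.≟ j
... | Relation.Nullary.yes _ = + 1
... | Relation.Nullary.no  _ = + 0

InLattice : (n : ℕ) → (x : Fin n → ℤ) → (α q : ℤ) → (Fin (suc n) → ℤ) → Set
InLattice n x α q v =
  Σ (Fin (suc n) → ℤ) λ k → ∀ col → v col ≡ sumFin (suc n) (λ j → k j * Bmat n x α q j col)

InDBall : (m : ℕ) → (d : ℕ) → (Fin m → ℤ) → Set
InDBall m d v = ∀ i → + ∣ v i ∣ ≤ + d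

-- A lattice vector is v = (α (k₀ q + Σ cᵢ xᵢ), c₁, …, cₙ) for integers k₀, cᵢ. If ‖v‖∞ ≤ d then
-- |cᵢ| ≤ d, so |Σ cᵢ xᵢ| ≤ d Σ |xᵢ| < q; and v₀ is a multiple of α with |v₀| ≤ d < α, so
-- k₀ q + Σ cᵢ xᵢ = 0. A multiple of q of absolute value below q vanishes, hence k₀ = 0 and
-- Σ cᵢ xᵢ = 0. Conversely k₀ = 0 realises every such (0, c₁, …, cₙ).
module Submission where

open import Defs
open import Data.Nat using (ℕ; suc)
open import Data.Integer using (ℤ; +_; _*_; ∣_∣; _<_; _≤_)
open import Data.Fin using (Fin; zero; suc)
open import Data.Product using (_×_)
open import Function.Bundles using (_⇔_)
open import Relation.Binary.PropositionalEquality using (_≡_)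

import Data.Nat as ℕ
import Data.Nat.Properties as ℕ
open import Data.Integer using (_+_; -_; +≤+)
open import Data.Integer.Properties
open import Data.Integer.Tactic.RingSolver using (solve-∀)
open import Data.Fin.Properties using (suc-injective) renaming (_≟_ to _≟ᶠ_)
open import Data.Vec.Functional using (_∷_; tail)
open import Data.Product using (Σ; _,_)
open import Data.Empty using (⊥-elim)
open import Relation.Nullary using (yes; no)
open import Relation.Binary.PropositionalEquality
  using (refl; sym; trans; cong; cong₂; subst; _≢_; module ≡-Reasoning)
open Function.Bundles using (mk⇔; Equivalence)

sumFin-cong : ∀ n {f g : Fin n → ℤ} → (∀ i → f i ≡ g i) → sumFin n f ≡ sumFin n g
sumFin-cong ℕ.zero    e = refl
sumFin-cong (suc n) e = cong₂ _+_ (e zero) (sumFin-cong n (λ i → e (suc i)))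

sumFin-*ˡ : ∀ n (c : ℤ) (f : Fin n → ℤ) → sumFin n (λ i → c * f i) ≡ c * sumFin n f
sumFin-*ˡ ℕ.zero    c f = sym (*-zeroʳ c)
sumFin-*ˡ (suc n) c f = trans (cong (_+_ (c * f zero)) (sumFin-*ˡ n c (λ i → f (suc i))))
                              (sym (*-distribˡ-+ c (f zero) _))

sumFin-mono-≤ : ∀ n {f g : Fin n → ℤ} → (∀ i → f i ≤ g i) → sumFin n f ≤ sumFin n g
sumFin-mono-≤ ℕ.zero    e = ≤-refl
sumFin-mono-≤ (suc n) e = +-mono-≤ (e zero) (sumFin-mono-≤ n (λ i → e (suc i)))

∣sumFin∣≤sumFin∣∣ : ∀ n (f : Fin n → ℤ) → + ∣ sumFin n f ∣ ≤ sumFin n (λ i → + ∣ f i ∣)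
∣sumFin∣≤sumFin∣∣ ℕ.zero    f = ≤-refl
∣sumFin∣≤sumFin∣∣ (suc n) f = begin
  + ∣ f zero + sumFin n tailf ∣                     ≤⟨ +≤+ (∣i+j∣≤∣i∣+∣j∣ (f zero) _) ⟩
  + ∣ f zero ∣ + + ∣ sumFin n tailf ∣               ≤⟨ +-monoʳ-≤ (+ ∣ f zero ∣) (∣sumFin∣≤sumFin∣∣ n tailf) ⟩
  + ∣ f zero ∣ + sumFin n (λ i → + ∣ tailf i ∣)     ∎
  where
  open ≤-Reasoning
  tailf : Fin n → ℤ
  tailf i = f (suc i)

sumFin-zero : ∀ n {f : Fin n → ℤ} → (∀ i → f i ≡ + 0) → sumFin n f ≡ + 0
sumFin-zero ℕ.zero    e = refl
sumFin-zero (suc n) e = cong₂ _+_ (e zero) (sumFin-zero n (λ i → e (suc i)))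

sumFin-single : ∀ n {f : Fin n → ℤ} (c : Fin n) → (∀ i → i ≢ c → f i ≡ + 0) → sumFin n f ≡ f c
sumFin-single (suc n) {f} zero    e =
  trans (cong (_+_ (f zero)) (sumFin-zero n (λ i → e (suc i) (λ ())))) (+-identityʳ (f zero))
sumFin-single (suc n) {f} (suc c) e =
  trans (cong (_+ sumFin n (λ i → f (suc i))) (e zero (λ ())))
        (trans (+-identityˡ _) (sumFin-single n c (λ i i≢c → e (suc i) (λ eq → i≢c (suc-injective eq)))))

∣weighted-sum∣≤ : ∀ n d (c x : Fin n → ℤ) → (∀ i → + ∣ c i ∣ ≤ + d) →
  + ∣ sumFin n (λ i → c i * x i) ∣ ≤ + d * sumFin n (λ i → + ∣ x i ∣)
∣weighted-sum∣≤ n d c x c≤d = begin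
  + ∣ sumFin n (λ i → c i * x i) ∣       ≤⟨ ∣sumFin∣≤sumFin∣∣ n _ ⟩
  sumFin n (λ i → + ∣ c i * x i ∣)       ≤⟨ sumFin-mono-≤ n term≤ ⟩
  sumFin n (λ i → + d * + ∣ x i ∣)       ≡⟨ sumFin-*ˡ n (+ d) _ ⟩
  + d * sumFin n (λ i → + ∣ x i ∣)       ∎
  where
  open ≤-Reasoning
  term≤ : ∀ i → + ∣ c i * x i ∣ ≤ + d * + ∣ x i ∣
  term≤ i rewrite abs-* (c i) (x i) | sym (pos-* d ∣ x i ∣) =
    +≤+ (ℕ.*-monoˡ-≤ ∣ x i ∣ (drop‿+≤+ (c≤d i)))

m*n<m⇒n≡0 : ∀ m n → m ℕ.* n ℕ.< m → n ≡ 0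
m*n<m⇒n≡0 m ℕ.zero _  = refl
m*n<m⇒n≡0 m (suc n) lt = ⊥-elim (ℕ.<⇒≱ lt (ℕ.m≤m*n m (suc n)))

∣m*n∣<∣m∣⇒n≡0 : ∀ m n → ∣ m * n ∣ ℕ.< ∣ m ∣ → n ≡ + 0
∣m*n∣<∣m∣⇒n≡0 m n lt = ∣i∣≡0⇒i≡0 (m*n<m⇒n≡0 ∣ m ∣ ∣ n ∣ (subst (ℕ._< ∣ m ∣) (abs-* m n) lt))

-- s ≡ q * (- a) is a multiple of q below |q| in absolute value.
*-+-small≡0⇒small≡0 : ∀ a q s → a * q + s ≡ + 0 → ∣ s ∣ ℕ.< ∣ q ∣ → s ≡ + 0
*-+-small≡0⇒small≡0 a q s aq+s≡0 ∣s∣<∣q∣ = begin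
  s              ≡⟨ sym (+-identityˡ s) ⟩
  + 0 + s        ≡⟨ cong (_+ s) (sym (*-zeroˡ q)) ⟩
  + 0 * q + s    ≡⟨ cong (λ t → t * q + s) (sym a≡0) ⟩
  a * q + s      ≡⟨ aq+s≡0 ⟩
  + 0            ∎
  where
  open ≡-Reasoning
  q*a≡-s : q * a ≡ - s
  q*a≡-s = begin
    q * a                ≡⟨ rearrange a q s ⟩
    (a * q + s) + - s    ≡⟨ cong (_+ - s) aq+s≡0 ⟩
    + 0 + - s            ≡⟨ +-identityˡ (- s) ⟩
    - s                  ∎
    where
    rearrange : ∀ a q s → q * a ≡ (a * q + s) + - s
    rearrange = solve-∀
  a≡0 : a ≡ + 0
  a≡0 = ∣m*n∣<∣m∣⇒n≡0 q a (subst (ℕ._< ∣ q ∣) (sym (trans (cong ∣_∣ q*a≡-s) (∣-i∣≡∣i∣ s))) ∣s∣<∣q∣)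

+m<n⇒m<∣n∣ : ∀ {m n} → + m < n → m ℕ.< ∣ n ∣
+m<n⇒m<∣n∣ {n = + _} m<n = drop‿+<+ m<n

α[tq+s]-short⇒≡0 : ∀ d α q t s → + d < α → + ∣ s ∣ < q → + ∣ α * (t * q + s) ∣ ≤ + d →
  t * q + s ≡ + 0 × s ≡ + 0
α[tq+s]-short⇒≡0 d α q t s d<α ∣s∣<q ∣v₀∣≤d = tq+s≡0 , *-+-small≡0⇒small≡0 t q s tq+s≡0 (+m<n⇒m<∣n∣ ∣s∣<q)
  where
  tq+s≡0 : t * q + s ≡ + 0
  tq+s≡0 = ∣m*n∣<∣m∣⇒n≡0 α (t * q + s) (ℕ.≤-<-trans (drop‿+≤+ ∣v₀∣≤d) (+m<n⇒m<∣n∣ d<α))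

module _ (n : ℕ) (x : Fin n → ℤ) (α q : ℤ) where

  Bmat-diag : (c : Fin n) → Bmat n x α q (suc c) (suc c) ≡ + 1
  Bmat-diag c with c ≟ᶠ c
  ... | yes _   = refl
  ... | no c≢c = ⊥-elim (c≢c refl)

  Bmat-offdiag : {i c : Fin n} → i ≢ c → Bmat n x α q (suc i) (suc c) ≡ + 0
  Bmat-offdiag {i} {c} i≢c with i ≟ᶠ c
  ... | yes i≡c = ⊥-elim (i≢c i≡c)
  ... | no _    = refl

  combination-zero : (k : Fin (suc n) → ℤ) →
    sumFin (suc n) (λ j → k j * Bmat n x α q j zero)
      ≡ α * (k zero * q + sumFin n (λ i → k (suc i) * x i))
  combination-zero k = begin
    k zero * (α * q) + sumFin n (λ i → k (suc i) * (α * x i))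
      ≡⟨ cong (_+_ (k zero * (α * q))) (sumFin-cong n (λ i → pull-α (k (suc i)) α (x i))) ⟩
    k zero * (α * q) + sumFin n (λ i → α * (k (suc i) * x i))
      ≡⟨ cong (_+_ (k zero * (α * q))) (sumFin-*ˡ n α _) ⟩
    k zero * (α * q) + α * S
      ≡⟨ pull-α-+ (k zero) α q S ⟩
    α * (k zero * q + S) ∎
    where
    open ≡-Reasoning
    S : ℤ
    S = sumFin n (λ i → k (suc i) * x i)
    pull-α : ∀ k α x → k * (α * x) ≡ α * (k * x)
    pull-α = solve-∀
    pull-α-+ : ∀ k α q s → k * (α * q) + α * s ≡ α * (k * q + s)
    pull-α-+ = solve-∀

  combination-suc : (k : Fin (suc n) → ℤ) (c : Fin n) →
    sumFin (suc n) (λ j → k j * Bmat n x α q j (suc c)) ≡ k (suc c)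
  combination-suc k c = begin
    k zero * + 0 + sumFin n (λ i → k (suc i) * Bmat n x α q (suc i) (suc c))
      ≡⟨ cong₂ _+_ (*-zeroʳ (k zero)) (sumFin-single n c off-c) ⟩
    + 0 + k (suc c) * Bmat n x α q (suc c) (suc c)
      ≡⟨ +-identityˡ _ ⟩
    k (suc c) * Bmat n x α q (suc c) (suc c)
      ≡⟨ cong (k (suc c) *_) (Bmat-diag c) ⟩
    k (suc c) * + 1
      ≡⟨ *-identityʳ (k (suc c)) ⟩
    k (suc c) ∎
    where
    open ≡-Reasoning
    off-c : ∀ i → i ≢ c → k (suc i) * Bmat n x α q (suc i) (suc c) ≡ + 0
    off-c i i≢c = trans (cong (k (suc i) *_) (Bmat-offdiag i≢c)) (*-zeroʳ (k (suc i)))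

  InLattice⇔ : (v : Fin (suc n) → ℤ) →
    InLattice n x α q v ⇔ Σ ℤ (λ t → v zero ≡ α * (t * q + sumFin n (λ i → v (suc i) * x i)))
  InLattice⇔ v = mk⇔ to from
    where
    to : InLattice n x α q v → Σ ℤ (λ t → v zero ≡ α * (t * q + sumFin n (λ i → v (suc i) * x i)))
    to (k , v≡kB) = k zero , trans (v≡kB zero) (trans (combination-zero k) (cong (λ s → α * (k zero * q + s)) Σk≡Σv))
      where
      Σk≡Σv : sumFin n (λ i → k (suc i) * x i) ≡ sumFin n (λ i → v (suc i) * x i)
      Σk≡Σv = sumFin-cong n (λ i → cong (_* x i) (sym (trans (v≡kB (suc i)) (combination-suc k i))))
    from : Σ ℤ (λ t → v zero ≡ α * (t * q + sumFin n (λ i → v (suc i) * x i))) → InLattice n x α q v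
    from (t , v₀≡) = t ∷ tail v , λ where
      zero    → trans v₀≡ (sym (combination-zero (t ∷ tail v)))
      (suc c) → sym (combination-suc (t ∷ tail v) c)

lemma3p2 : (n d : ℕ) (x : Fin n → ℤ) (α q : ℤ) →
    + d < α →
    + d * sumFin n (λ i → + ∣ x i ∣) < q →
    (v : Fin (suc n) → ℤ) →
    (InLattice n x α q v × InDBall (suc n) d v)
      ⇔ ((v zero ≡ + 0) × (sumFin n (λ i → v (suc i) * x i) ≡ + 0) × (∀ i → + ∣ v (suc i) ∣ ≤ + d))
lemma3p2 n d x α q d<α dΣ∣x∣<q v = mk⇔ to from
  where
  S : ℤ
  S = sumFin n (λ i → v (suc i) * x i)

  ∣S∣<q : InDBall (suc n) d v → + ∣ S ∣ < q
  ∣S∣<q ∣v∣≤d = ≤-<-trans (∣weighted-sum∣≤ n d (tail v) x (λ i → ∣v∣≤d (suc i))) dΣ∣x∣<q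

  to : InLattice n x α q v × InDBall (suc n) d v →
       (v zero ≡ + 0) × (S ≡ + 0) × (∀ i → + ∣ v (suc i) ∣ ≤ + d)
  to (lattice , ∣v∣≤d) with Equivalence.to (InLattice⇔ n x α q v) lattice
  ... | t , v₀≡ with α[tq+s]-short⇒≡0 d α q t S d<α (∣S∣<q ∣v∣≤d) (subst (λ v₀ → + ∣ v₀ ∣ ≤ + d) v₀≡ (∣v∣≤d zero))
  ... | tq+S≡0 , S≡0 = trans v₀≡ (trans (cong (α *_) tq+S≡0) (*-zeroʳ α)) , S≡0 , λ i → ∣v∣≤d (suc i)

  from : (v zero ≡ + 0) × (S ≡ + 0) × (∀ i → + ∣ v (suc i) ∣ ≤ + d) →
         InLattice n x α q v × InDBall (suc n) d v
  from (v₀≡0 , S≡0 , ∣vᵢ∣≤d) = Equivalence.from (InLattice⇔ n x α q v) (+ 0 , v₀≡) , ∣v∣≤d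
    where
    v₀≡ : v zero ≡ α * (+ 0 * q + S)
    v₀≡ = begin
      v zero              ≡⟨ v₀≡0 ⟩
      + 0                 ≡⟨ sym (*-zeroʳ α) ⟩
      α * + 0             ≡⟨ cong (α *_) (sym S≡0) ⟩
      α * S               ≡⟨ cong (α *_) (sym (+-identityˡ S)) ⟩
      α * (+ 0 + S)       ≡⟨ cong (λ s → α * (s + S)) (sym (*-zeroˡ q)) ⟩
      α * (+ 0 * q + S)   ∎
      where open ≡-Reasoning
    ∣v∣≤d : InDBall (suc n) d v
    ∣v∣≤d zero    rewrite v₀≡0 = +≤+ ℕ.z≤n
    ∣v∣≤d (suc i) = ∣vᵢ∣≤d i
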